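{- Let $M$ be a matroid on $[n]$, $\mathcal{C}_L$ a linear class of circuits of $M$, and $\mathbf{K}$ a field. For each $h\ge 0$, the set of linear forms $\{\mathfrak{p}_I: I\in\operatorname{NBC}_{\mathcal{C}_L},|I|=h\}$ on $\operatorname{Z}(M,\mathcal{C}_L)_h$ is the dual basis of the basis $\{e_J: J\in\operatorname{NBC}_{\mathcal{C}_L},|J|=h\}$ of $\operatorname{Z}(M,\mathcal{C}_L)_h$; that is, $\mathfrak{p}_I(e_J)=\delta_{IJ}$ for all $I,J\in\operatorname{NBC}_{\mathcal{C}_L}$ with $|I|=|J|$. Consequently $\{\mathfrak{p}_I: I\in\operatorname{NBC}_{\mathcal{C}_L}\}$ is the dual basis of $\mathbf{nbc}_{\mathcal{C}_L}=\{e_I: I\in\operatorname{NBC}_{\mathcal{C}_L}\}$.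
   Context: Linear class: $\mathcal{C}_L\subseteq\mathcal{C}(M)$ such that whenever $C_1,C_2\in\mathcal{C}_L$ satisfy $\operatorname{r}(C_1)+\operatorname{r}(C_2)=\operatorname{r}(C_1\cup C_2)+\operatorname{r}(C_1\cap C_2)$, every circuit of $M$ in $C_1\cup C_2$ is in $\mathcal{C}_L$. For a non-loop $x$, $\mathcal{C}_L/x=\{C\setminus x: x\in C\in\mathcal{C}_L\}\cup\{C\in\mathcal{C}_L:x\notin\operatorname{cl}_M(C)\}$, a linear class of $M/x$. For a matroid $M$ on a linearly ordered finite set $S$ with linear class $\mathcal{C}_L$: $e_X=e_{i_1}\wedge\dots\wedge e_{i_m}$ for $X=\{i_1<\dots<i_m\}$, $e_\emptyset=1$, $\partial e_X=\sum_j(-1)^je_{X\setminus i_j}$, $\partial e_\emptyset=0$; $\operatorname{OS}(N)$ is the exterior algebra on the elements of $N$ modulo the ideal generated by $\partial e_C$ ($C$ circuit, $|C|>1$) and $e_C$ ($C$ circuit); the extended lift $N$ on $S\cup\{p\}$ is the dual of the single-element extension $N^\star$ of $M^\star$ with $p\in\operatorname{cl}_{N^\star}(H)$ iff $S\setminus H\in\mathcal{C}_L$ for each hyperplane $H$ of $M^\star$; the bias algebra is $\operatorname{Z}(M,\mathcal{C}_L)=\operatorname{OS}(N)/\langle e_p\rangle$, graded by degree, and $\operatorname{Z}(M,\mathcal{C}_L)_h$ is the subspace spanned by $e_X$ with $X$ independent, $|X|=h$. For a non-loop $x$, $\mathfrak{p}_x:\operatorname{Z}(M,\mathcal{C}_L)\to\operatorname{Z}(M/x,\mathcal{C}_L/x)$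 is the linear map with $\mathfrak{p}_xe_I=e_{I\setminus x}$ if $x\in I$, $\mathfrak{p}_xe_I=\pm e_{I\setminus y}$ if some $y\in I$ has $\{x,y\}\in\mathcal{C}_L$ (sign of the permutation replacing $y$ by $x$ in $I$), and $0$ otherwise. For an independent set $I=\{i_1<\dots<i_h\}$ of $M$, $\mathfrak{p}_I:=\mathfrak{p}_{i_1}\circ\mathfrak{p}_{i_2}\circ\dots\circ\mathfrak{p}_{i_h}$ (each $\mathfrak{p}_{i_t}$ taken for the successively contracted pair $(M/\{i_{t+1},\dots,i_h\},\cdot)$), restricted to $\operatorname{Z}(M,\mathcal{C}_L)_h$; it is a linear form with values in $\mathbf{K}$. For $C\in\mathcal{C}_L$ with $|C|>1$, $C\setminus\min C$ is a $\mathcal{C}_L$-broken circuit, and $\operatorname{NBC}_{\mathcal{C}_L}$ is the family of independent sets of $M$ containing no $\mathcal{C}_L$-broken circuit. -}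

module Defs where

open import Level using (Level; _⊔_) renaming (suc to lsuc)
open import Data.Nat using (ℕ; zero; suc; _+_; _∸_; _≤_; _<_; _≡ᵇ_; _<ᵇ_)
open import Data.Bool using (Bool; true; false; if_then_else_; not; _∧_; _∨_)
open import Data.Integer as ℤ using (ℤ; +_; -[1+_])
open import Data.Fin using (Fin; toℕ)
open import Data.Fin.Subset using (Subset; ⁅_⁆; _∈_; _⊆_; _∪_; _∩_; _-_; ∣_∣)
open import Data.Vec using (lookup)
open import Data.List using (List; []; _∷_; allFin; filterᵇ; reverse; length)
open import Data.Maybe using (Maybe; just; nothing)
open import Data.Product using (Σ; ∃; _×_; _,_)
open import Relation.Nullary using (¬_)
open import Relation.Binary.PropositionalEquality using (_≡_)
open import Algebra.Bundles using (CommutativeRing)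

record Field (c ℓ : Level) : Set (lsuc (c ⊔ ℓ)) where
  field
    commutativeRing : CommutativeRing c ℓ
  open CommutativeRing commutativeRing public
  field
    1≉0     : ¬ (1# ≈ 0#)
    inverse : ∀ x → ¬ (x ≈ 0#) → ∃ λ y → x * y ≈ 1#

ℕ→K : ∀ {c ℓ} (K : Field c ℓ) → ℕ → Field.Carrier K
ℕ→K K zero    = Field.0# K
ℕ→K K (suc m) = Field._+_ K (Field.1# K) (ℕ→K K m)

ℤ→K : ∀ {c ℓ} (K : Field c ℓ) → ℤ → Field.Carrier K
ℤ→K K (+ m)    = ℕ→K K m
ℤ→K K -[1+ m ] = Field.-_ K (ℕ→K K (suc m))

-- Matroids on the linearly ordered ground set [n] = Fin n
-- (order = the order of Fin), given by their rank function.

record Matroid (n : ℕ) : Set where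
  field
    rank        : Subset n → ℕ
    rank-bound  : ∀ X → rank X ≤ ∣ X ∣
    rank-mono   : ∀ X Y → X ⊆ Y → rank X ≤ rank Y
    rank-submod : ∀ X Y → rank (X ∪ Y) + rank (X ∩ Y) ≤ rank X + rank Y

module _ {n : ℕ} (M : Matroid n) where
  open Matroid M

  Independent : Subset n → Set
  Independent X = rank X ≡ ∣ X ∣

  Circuit : Subset n → Set
  Circuit C = ¬ Independent C × (∀ x → x ∈ C → Independent (C - x))

record LinearClass {n : ℕ} (M : Matroid n) : Set where
  open Matroid M
  field
    inL        : Subset n → Bool
    circuits   : ∀ C → inL C ≡ true → Circuit M C
    linear     : ∀ C₁ C₂ → inL C₁ ≡ true → inL C₂ ≡ true →
                 rank C₁ + rank C₂ ≡ rank (C₁ ∪ C₂) + rank (C₁ ∩ C₂) →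
                 ∀ C → Circuit M C → C ⊆ (C₁ ∪ C₂) → inL C ≡ true

module _ {n : ℕ} {M : Matroid n} (L : LinearClass M) where
  open LinearClass L

  BrokenCircuit : Subset n → Set
  BrokenCircuit B =
    Σ (Subset n) λ C → Σ (Fin n) λ c →
      inL C ≡ true × 1 < ∣ C ∣ × c ∈ C ×
      (∀ d → d ∈ C → toℕ c ≤ toℕ d) × B ≡ C - c

  NBC : Subset n → Set
  NBC I = Independent M I × (∀ B → BrokenCircuit B → ¬ (B ⊆ I))

-- A (minor of a) matroid is handled through a raw rank function on the
-- whole ground set [n]; M/x is modelled by r_{M/x}(Y) = r(Y ∪ x) - r(x)
-- (x becomes a loop, never used afterwards).

_∈ᵇ_ : ∀ {n} → Fin n → Subset n → Bool
x ∈ᵇ Y = lookup Y x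

contrRank : ∀ {n} → (Subset n → ℕ) → Fin n → (Subset n → ℕ)
contrRank r x Y = r (Y ∪ ⁅ x ⁆) ∸ r ⁅ x ⁆

inClᵇ : ∀ {n} → (Subset n → ℕ) → Subset n → Fin n → Bool
inClᵇ r Y z = r (Y ∪ ⁅ z ⁆) ≡ᵇ r Y

contrClass : ∀ {n} → (Subset n → ℕ) → (Subset n → Bool) → Fin n →
             (Subset n → Bool)
contrClass r L x Y =
  not (x ∈ᵇ Y) ∧ (L (Y ∪ ⁅ x ⁆) ∨ (L Y ∧ not (inClᵇ r Y x)))

firstWith : ∀ {n} → (Fin n → Bool) → Maybe (Fin n)
firstWith {n} f with filterᵇ f (allFin n)
... | []    = nothing
... | y ∷ _ = just y

sgn : ℕ → ℤ
sgn zero    = + 1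
sgn (suc k) = ℤ.- sgn k

-- sign of the permutation replacing y by x in the sorted set J
-- = (-1)^(number of elements of J strictly between x and y)
swapSign : ∀ {n} → Subset n → Fin n → Fin n → ℤ
swapSign {n} J x y = sgn (length (filterᵇ between (allFin n)))
  where
  between : Fin n → Bool
  between z = (z ∈ᵇ J) ∧
    (((toℕ x <ᵇ toℕ z) ∧ (toℕ z <ᵇ toℕ y)) ∨
     ((toℕ y <ᵇ toℕ z) ∧ (toℕ z <ᵇ toℕ x)))

-- 𝔭_x applied to the monomial  s · e_J  (result: s' · e_J')
pStep : ∀ {n} → (Subset n → ℕ) → (Subset n → Bool) → Fin n →
        Subset n × ℤ → Subset n × ℤ
pStep r L x (J , s) with x ∈ᵇ J
... | true  = (J - x , s)
... | false with firstWith (λ y → (y ∈ᵇ J) ∧ L (⁅ x ⁆ ∪ ⁅ y ⁆))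
...   | just y  = (J - y , swapSign J x y ℤ.* s)
...   | nothing = (J , + 0)

-- apply 𝔭_{x_1} ∘ … ∘ 𝔭_{x_k} for the list x_k, …, x_1 (applied in list
-- order, successively contracting) and take the degree-0 coefficient
pChain : ∀ {n} → (Subset n → ℕ) → (Subset n → Bool) → List (Fin n) →
         Subset n × ℤ → ℤ
pChain r L []       (J , s) = if ∣ J ∣ ≡ᵇ 0 then s else + 0
pChain r L (x ∷ xs) Js      =
  pChain (contrRank r x) (contrClass r L x) xs (pStep r L x Js)

elemsDesc : ∀ {n} → Subset n → List (Fin n)
elemsDesc {n} I = reverse (filterᵇ (λ i → i ∈ᵇ I) (allFin n))

-- 𝔭_I (e_J) ∈ 𝐊, for I = {i_1 < … < i_h}:
-- 𝔭_I = 𝔭_{i_1} ∘ 𝔭_{i_2} ∘ … ∘ 𝔭_{i_h}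
pForm : ∀ {n c ℓ} (K : Field c ℓ) (M : Matroid n) (L : LinearClass M) →
        Subset n → Subset n → Field.Carrier K
pForm K M L I J =
  ℤ→K K (pChain (Matroid.rank M) (LinearClass.inL L) (elemsDesc I) (J , + 1))

{-# OPTIONS --safe #-}
-- 𝔭_I e_J contracts the elements of I one at a time, from the largest down.  While the
-- current element x of I still lies in the monomial, 𝔭_x just deletes it, so after
-- contracting X ⊆ I ∩ J the monomial is e_{J ─ X}.  If x has already left J ─ X, then
-- x ∉ J (so I ≠ J), and 𝔭_x could only survive through a partner y ∈ J ─ X with {x, y}
-- in the contracted class.  Such a pair lifts to some C ∈ C_L with {x, y} ⊆ C ⊆ {x, y} ∪ X;
-- every element of X exceeds x, so min C is x or y, and C ∖ min C is a broken circuit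
-- inside J or inside I.  Hence for NBC sets either such an x occurs and 𝔭_I e_J = 0, or
-- I ⊆ J and the chain ends on e_{J ─ I}, whose degree-0 part is δ_IJ.
module Submission where

open import Defs
open import Data.Nat using (ℕ)
open import Data.Fin.Subset using (Subset; ∣_∣)
open import Data.Product using (_×_)
open import Relation.Binary.PropositionalEquality using (_≡_; _≢_)

open import Level using (_⊔_)
open import Function using (_∘_; flip; id)
open import Function.Bundles using (Equivalence)
open import Data.Bool using (Bool; true; false; T; _∧_; not)
open import Data.Bool.Properties using (∧-conicalˡ; ∧-conicalʳ; T-≡)
open import Relation.Nullary.Decidable using (T?)
open import Data.Nat as ℕ using (z≤n; s≤s)
import Data.Nat.Properties as ℕₚ
open import Data.Fin using (Fin; _≤_; _<_; _>_) renaming (zero to fzero; suc to fsuc)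
open import Data.Fin.Properties using (<-irrefl)
open import Data.Fin.Subset
  using (_∈_; _∉_; _⊆_; _∪_; _─_; _-_; ⁅_⁆; ⊥; Empty; inside; outside)
open import Data.Fin.Subset.Properties
  using (_∈?_; x∈⁅x⁆; x∈⁅y⁆⇒x≡y; ∣⁅x⁆∣≡1; ⊆-reflexive; ⊆-trans; ⊆-antisym;
         ∪-assoc; ∪-comm; ⊥⊆; ∉⊥; ∣⊥∣≡0;
         Empty-unique; p⊆q⇒∣p∣≤∣q∣; p⊆p∪q; q⊆p∪q; x∈p∪q⁻; p─⊥≡p;
         p─q─r≡p─q∪r; x∈p∧x∉q⇒x∈p─q; p─q⊆p; x∈p∧x≢y⇒x∈p-y; x∈p⇒∣p-x∣<∣p∣)
open import Data.Vec using (_∷_; here; there)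
open import Data.Vec.Properties using ([]=⇒lookup; lookup⇒[]=)
open import Data.List using (List; []; _∷_; reverse; allFin; filterᵇ)
open import Data.List.Properties using (unfold-reverse)
open import Data.List.Membership.Propositional using () renaming (_∈_ to _∈ₗ_)
open import Data.List.Membership.Propositional.Properties using (∈-filter⁺; ∈-filter⁻; ∈-allFin)
open import Data.List.Relation.Unary.All as All using (All; []; _∷_)
open import Data.List.Relation.Unary.All.Properties using (all-filter)
open import Data.List.Relation.Unary.Any using (here; there)
import Data.List.Relation.Unary.Any.Properties as Any
open import Data.List.Relation.Unary.AllPairs as AllPairs using (AllPairs; []; _∷_)
import Data.List.Relation.Unary.AllPairs.Properties as AllPairs
open import Data.Maybe using (just; nothing)
open import Data.Product using (∃-syntax; _,_; proj₂)
open import Data.Sum using (_⊎_; inj₁; inj₂)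
open import Data.Integer using (ℤ; +_)
open import Data.Integer.Properties using (*-zeroʳ)
open import Relation.Nullary using (¬_; yes; no; contradiction)
open import Relation.Binary.PropositionalEquality
  using (refl; sym; trans; cong; subst; module ≡-Reasoning)

private variable
  n : ℕ
  p q : Subset n
  x y : Fin n

x∈p⇒⁅x⁆⊆p : x ∈ p → ⁅ x ⁆ ⊆ p
x∈p⇒⁅x⁆⊆p {x = x} {p = p} x∈p z∈⁅x⁆ = subst (_∈ p) (sym (x∈⁅y⁆⇒x≡y x z∈⁅x⁆)) x∈p

∪-least : ∀ {r : Subset n} → p ⊆ r → q ⊆ r → p ∪ q ⊆ r
∪-least {p = p} {q = q} p⊆r q⊆r z∈p∪q with x∈p∪q⁻ p q z∈p∪q
... | inj₁ z∈p = p⊆r z∈p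
... | inj₂ z∈q = q⊆r z∈q

∪-monoʳ : ∀ {r : Subset n} → q ⊆ r → p ∪ q ⊆ p ∪ r
∪-monoʳ {p = p} {r = r} q⊆r = ∪-least (p⊆p∪q r) (⊆-trans q⊆r (q⊆p∪q p r))

x∈p∪⁅y⁆⁻ : x ∈ p ∪ ⁅ y ⁆ → x ∈ p ⊎ x ≡ y
x∈p∪⁅y⁆⁻ {p = p} {y = y} x∈p∪⁅y⁆ with x∈p∪q⁻ p ⁅ y ⁆ x∈p∪⁅y⁆
... | inj₁ x∈p    = inj₁ x∈p
... | inj₂ x∈⁅y⁆ = inj₂ (x∈⁅y⁆⇒x≡y y x∈⁅y⁆)

x∈p─q⇒x∉q : ∀ (p q : Subset n) → x ∈ p ─ q → x ∉ q
x∈p─q⇒x∉q (_ ∷ p) (inside ∷ q) () here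
x∈p─q⇒x∉q (_ ∷ p) (_ ∷ q) (there x∈p─q) (there x∈q) = x∈p─q⇒x∉q p q x∈p─q x∈q

p⊆⁅x⁆∪q⇒p-x⊆q : ∀ (p : Subset n) → p ⊆ ⁅ x ⁆ ∪ q → p - x ⊆ q
p⊆⁅x⁆∪q⇒p-x⊆q {x = x} {q = q} p p⊆⁅x⁆∪q z∈p-x
  with x∈p∪q⁻ ⁅ x ⁆ q (p⊆⁅x⁆∪q (p─q⊆p p ⁅ x ⁆ z∈p-x))
... | inj₁ z∈⁅x⁆ = contradiction z∈⁅x⁆ (x∈p─q⇒x∉q p ⁅ x ⁆ z∈p-x)
... | inj₂ z∈q    = z∈q

x∈p⇒0<∣p∣ : x ∈ p → 0 ℕ.< ∣ p ∣
x∈p⇒0<∣p∣ {x = x} x∈p = subst (ℕ._≤ _) (∣⁅x⁆∣≡1 x) (p⊆q⇒∣p∣≤∣q∣ (x∈p⇒⁅x⁆⊆p x∈p))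

∣p∣≡0⇒Empty : ∣ p ∣ ≡ 0 → Empty p
∣p∣≡0⇒Empty ∣p∣≡0 (_ , x∈p) = ℕₚ.<-irrefl (sym ∣p∣≡0) (x∈p⇒0<∣p∣ x∈p)

x∈p∧y∈p∧x≢y⇒1<∣p∣ : x ∈ p → y ∈ p → x ≢ y → 1 ℕ.< ∣ p ∣
x∈p∧y∈p∧x≢y⇒1<∣p∣ x∈p y∈p x≢y =
  ℕₚ.≤-<-trans (x∈p⇒0<∣p∣ (x∈p∧x≢y⇒x∈p-y y∈p (x≢y ∘ sym))) (x∈p⇒∣p-x∣<∣p∣ x∈p)

∃-minimum : ∀ (p : Subset n) → x ∈ p → ∃[ c ] c ∈ p × (∀ d → d ∈ p → c ≤ d)
∃-minimum (inside ∷ p) _ = fzero , here , λ _ _ → z≤n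
∃-minimum (outside ∷ p) (there x∈p) =
  let c , c∈p , c-min = ∃-minimum p x∈p
  in fsuc c , there c∈p , λ { fzero () ; (fsuc d) (there d∈p) → s≤s (c-min d d∈p) }

AllPairs-reverse⁺ : ∀ {a ℓ} {A : Set a} {R : A → A → Set ℓ} {xs : List A} →
                    AllPairs R xs → AllPairs (flip R) (reverse xs)
AllPairs-reverse⁺ [] = []
AllPairs-reverse⁺ {R = R} {x ∷ xs} (Rx ∷ Rxs) =
  subst (AllPairs (flip R)) (sym (unfold-reverse x xs))
    (AllPairs.++⁺ (AllPairs-reverse⁺ Rxs) ([] ∷ [])
      (All.tabulate (λ w∈ → All.lookup Rx (Any.reverse⁻ w∈) ∷ [])))

∈-elemsDesc⁻ : ∀ (p : Subset n) → x ∈ₗ elemsDesc p → x ∈ p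
∈-elemsDesc⁻ {n} {x} p x∈ =
  lookup⇒[]= x p (Equivalence.to T-≡
    (proj₂ (∈-filter⁻ (T? ∘ (_∈ᵇ p)) {xs = allFin n} (Any.reverse⁻ x∈))))

∈-elemsDesc⁺ : x ∈ p → x ∈ₗ elemsDesc p
∈-elemsDesc⁺ {x = x} {p = p} x∈p =
  Any.reverse⁺ (∈-filter⁺ (T? ∘ (_∈ᵇ p)) (∈-allFin x) (Equivalence.from T-≡ ([]=⇒lookup x∈p)))

elemsDesc-decreasing : ∀ (p : Subset n) → AllPairs _>_ (elemsDesc p)
elemsDesc-decreasing p =
  AllPairs-reverse⁺ (AllPairs.filter⁺ (T? ∘ (_∈ᵇ p)) (AllPairs.tabulate⁺-< id))

firstWith-sound : ∀ (f : Fin n → Bool) → firstWith f ≡ just y → f y ≡ true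
firstWith-sound {n} f found with filterᵇ f (allFin n) in e
firstWith-sound {n} f refl | y ∷ _ =
  Equivalence.to T-≡ (All.head (subst (All (T ∘ f)) e (all-filter (T? ∘ f) (allFin n))))

pStep-zero : ∀ (rk : Subset n → ℕ) L x {J s} → s ≡ + 0 → proj₂ (pStep rk L x (J , s)) ≡ + 0
pStep-zero rk L x {J} refl with x ∈ᵇ J
... | true = refl
... | false with firstWith (λ y → (y ∈ᵇ J) ∧ L (⁅ x ⁆ ∪ ⁅ y ⁆))
...   | just y  = *-zeroʳ (swapSign J x y)
...   | nothing = refl

pChain-zero : ∀ (rk : Subset n → ℕ) L xs {J s} → s ≡ + 0 → pChain rk L xs (J , s) ≡ + 0
pChain-zero rk L [] {J} refl with ∣ J ∣ ℕ.≡ᵇ 0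
... | true  = refl
... | false = refl
pChain-zero rk L (x ∷ xs) {J} s≡0 =
  pChain-zero (contrRank rk x) (contrClass rk L x) xs (pStep-zero rk L x {J} s≡0)

module _ (rk : Subset n → ℕ) (L : Subset n → Bool) {J : Subset n} {s : ℤ} where

  pChain-[]-Empty : Empty J → pChain rk L [] (J , s) ≡ s
  pChain-[]-Empty empty rewrite Empty-unique empty | ∣⊥∣≡0 n = refl

  pChain-[]-¬Empty : ¬ Empty J → pChain rk L [] (J , s) ≡ + 0
  pChain-[]-¬Empty nonempty with ∣ J ∣ ℕ.≡ᵇ 0 in ∣J∣≡ᵇ0
  ... | false = refl
  ... | true  =
    contradiction (∣p∣≡0⇒Empty (ℕₚ.≡ᵇ⇒≡ ∣ J ∣ 0 (Equivalence.from T-≡ ∣J∣≡ᵇ0))) nonempty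

  pChain-∷-∈ : ∀ {x xs} → x ∈ J → pChain rk L (x ∷ xs) (J , s) ≡
               pChain (contrRank rk x) (contrClass rk L x) xs (J - x , s)
  pChain-∷-∈ x∈J rewrite []=⇒lookup x∈J = refl

  pChain-∷-∉ : ∀ {x xs} → x ∉ J → (∀ {y} → y ∈ J → L (⁅ x ⁆ ∪ ⁅ y ⁆) ≢ true) →
               pChain rk L (x ∷ xs) (J , s) ≡ + 0
  pChain-∷-∉ {x} {xs} x∉J no-partner with x ∈ᵇ J in x∈ᵇJ
  ... | true = contradiction (lookup⇒[]= x J x∈ᵇJ) x∉J
  ... | false with firstWith (λ y → (y ∈ᵇ J) ∧ L (⁅ x ⁆ ∪ ⁅ y ⁆)) in found
  ...   | nothing = pChain-zero (contrRank rk x) (contrClass rk L x) xs refl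
  ...   | just y  =
    let partner = firstWith-sound (λ y → (y ∈ᵇ J) ∧ L (⁅ x ⁆ ∪ ⁅ y ⁆)) found
    in contradiction (∧-conicalʳ _ _ partner) (no-partner (lookup⇒[]= y J (∧-conicalˡ _ _ partner)))

-- Contraction only shrinks members of the class, so iterated contractions of C_L by X stay
-- liftable to C_L; this is all the argument uses of contrClass (the rank never matters).
Liftable : (Subset n → Bool) → Subset n → (Subset n → Bool) → Set
Liftable L X L′ = ∀ Y → L′ Y ≡ true → ∃[ C ] L C ≡ true × Y ⊆ C × C ⊆ Y ∪ X

liftable-refl : ∀ {L : Subset n → Bool} → Liftable L ⊥ L
liftable-refl Y Y∈L = Y , Y∈L , id , p⊆p∪q ⊥

liftable-contrClass : ∀ (rk : Subset n → ℕ) {L L′ X} → Liftable L X L′ →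
                      Liftable L (X ∪ ⁅ x ⁆) (contrClass rk L′ x)
liftable-contrClass {x = x} rk {L′ = L′} {X} lift Y Y∈L′/x with L′ (Y ∪ ⁅ x ⁆) in Y+x∈L′
... | true =
  let C , C∈L , Y+x⊆C , C⊆Y+x∪X = lift (Y ∪ ⁅ x ⁆) Y+x∈L′
  in C , C∈L , ⊆-trans (p⊆p∪q ⁅ x ⁆) Y+x⊆C ,
     ⊆-trans C⊆Y+x∪X (⊆-reflexive (trans (∪-assoc Y ⁅ x ⁆ X) (cong (Y ∪_) (∪-comm ⁅ x ⁆ X))))
... | false =
  let C , C∈L , Y⊆C , C⊆Y∪X = lift Y (∧-conicalˡ (L′ Y) _ (∧-conicalʳ (not (x ∈ᵇ Y)) _ Y∈L′/x))
  in C , C∈L , Y⊆C , ⊆-trans C⊆Y∪X (∪-monoʳ (p⊆p∪q ⁅ x ⁆))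

BrokenCircuitFree : ∀ {M : Matroid n} → LinearClass M → Subset n → Set
BrokenCircuitFree L I = ∀ B → BrokenCircuit L B → ¬ (B ⊆ I)

module _ {M : Matroid n} (L : LinearClass M) where
  open LinearClass L using (inL)

  no-circuit-containing-pair :
    ∀ {I J X} → BrokenCircuitFree L I → BrokenCircuitFree L J →
    x ∈ I → y ∈ J → x ≢ y → X ⊆ I → X ⊆ J → (∀ {z} → z ∈ X → x < z) →
    ¬ (∃[ C ] inL C ≡ true × ⁅ x ⁆ ∪ ⁅ y ⁆ ⊆ C × C ⊆ (⁅ x ⁆ ∪ ⁅ y ⁆) ∪ X)
  no-circuit-containing-pair {x = x} {y = y} {I} {J} {X}
    I-free J-free x∈I y∈J x≢y X⊆I X⊆J x<X (C , C∈L , x+y⊆C , C⊆x+y∪X) =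
    no-minimum (∃-minimum C x∈C)
    where
    x∈C : x ∈ C
    x∈C = x+y⊆C (p⊆p∪q ⁅ y ⁆ (x∈⁅x⁆ x))

    y∈C : y ∈ C
    y∈C = x+y⊆C (q⊆p∪q ⁅ x ⁆ ⁅ y ⁆ (x∈⁅x⁆ y))

    C-x⊆J : C - x ⊆ J
    C-x⊆J = p⊆⁅x⁆∪q⇒p-x⊆q C (⊆-trans C⊆x+y∪X
      (∪-least (∪-monoʳ (x∈p⇒⁅x⁆⊆p y∈J)) (⊆-trans X⊆J (q⊆p∪q ⁅ x ⁆ J))))

    C-y⊆I : C - y ⊆ I
    C-y⊆I = p⊆⁅x⁆∪q⇒p-x⊆q C (⊆-trans C⊆x+y∪X
      (∪-least (∪-least (⊆-trans (x∈p⇒⁅x⁆⊆p x∈I) (q⊆p∪q ⁅ y ⁆ I)) (p⊆p∪q I))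
               (⊆-trans X⊆I (q⊆p∪q ⁅ y ⁆ I))))

    C-min-broken : ∀ {c} → c ∈ C → (∀ d → d ∈ C → c ≤ d) → BrokenCircuit L (C - c)
    C-min-broken c∈C c-min = C , _ , C∈L , x∈p∧y∈p∧x≢y⇒1<∣p∣ x∈C y∈C x≢y , c∈C , c-min , refl

    no-minimum : ¬ (∃[ c ] c ∈ C × (∀ d → d ∈ C → c ≤ d))
    no-minimum (c , c∈C , c-min) with x∈p∪q⁻ (⁅ x ⁆ ∪ ⁅ y ⁆) X (C⊆x+y∪X c∈C)
    ... | inj₂ c∈X = ℕₚ.<⇒≱ (x<X c∈X) (c-min x x∈C)
    ... | inj₁ c∈x+y with x∈p∪q⁻ ⁅ x ⁆ ⁅ y ⁆ c∈x+y
    ...   | inj₁ c∈⁅x⁆ with refl ← x∈⁅y⁆⇒x≡y x c∈⁅x⁆ = J-free (C - x) (C-min-broken c∈C c-min) C-x⊆J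
    ...   | inj₂ c∈⁅y⁆ with refl ← x∈⁅y⁆⇒x≡y y c∈⁅y⁆ = I-free (C - y) (C-min-broken c∈C c-min) C-y⊆I

Kronecker : ∀ {a b ℓ} {Ix : Set a} {A : Set b} → (A → A → Set ℓ) → A → A → Ix → Ix → A → Set (a ⊔ ℓ)
Kronecker _≈_ one zero i j v = (i ≡ j → v ≈ one) × (i ≢ j → v ≈ zero)

Kronecker-map : ∀ {a b c ℓ} {Ix : Set a} {A : Set b} {B : Set c} {_≈_ : B → B → Set ℓ}
                {one zero : A} {one′ zero′ : B} {i j : Ix} {v : A} (f : A → B) →
                f one ≈ one′ → f zero ≈ zero′ →
                Kronecker _≡_ one zero i j v → Kronecker _≈_ one′ zero′ i j (f v)
Kronecker-map {_≈_ = _≈_} {one′ = one′} {zero′} f f-one f-zero (i≡j⇒one , i≢j⇒zero) =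
  (λ i≡j → subst (λ w → f w ≈ one′) (sym (i≡j⇒one i≡j)) f-one) ,
  (λ i≢j → subst (λ w → f w ≈ zero′) (sym (i≢j⇒zero i≢j)) f-zero)

module Duality {M : Matroid n} (L : LinearClass M) {I J : Subset n}
               (I-free : BrokenCircuitFree L I) (J-free : BrokenCircuitFree L J) where
  open LinearClass L using (inL)

  -- State of 𝔭_I after contracting X: the monomial is e_{J ─ X}, the rest of I is xs.
  record Invariant (L′ : Subset n → Bool) (X : Subset n) (xs : List (Fin n)) : Set where
    field
      liftable   : Liftable inL X L′
      X⊆I        : X ⊆ I
      X⊆J        : X ⊆ J
      xs⊆I       : All (_∈ I) xs
      I⊆X∪xs     : ∀ {z} → z ∈ I → z ∈ X ⊎ z ∈ₗ xs
      decreasing : AllPairs _>_ xs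
      X-above-xs : ∀ {z} → z ∈ X → All (_< z) xs

  invariant-init : Invariant inL ⊥ (elemsDesc I)
  invariant-init = record
    { liftable   = liftable-refl
    ; X⊆I        = ⊥⊆
    ; X⊆J        = ⊥⊆
    ; xs⊆I       = All.tabulate (∈-elemsDesc⁻ I)
    ; I⊆X∪xs     = inj₂ ∘ ∈-elemsDesc⁺
    ; decreasing = elemsDesc-decreasing I
    ; X-above-xs = λ z∈⊥ → contradiction z∈⊥ ∉⊥
    }

  invariant-step : ∀ (rk : Subset n → ℕ) {L′ X xs} → Invariant L′ X (x ∷ xs) → x ∈ J →
                   Invariant (contrClass rk L′ x) (X ∪ ⁅ x ⁆) xs
  invariant-step {x = x} rk {X = X} {xs} inv x∈J = record
    { liftable   = liftable-contrClass rk liftable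
    ; X⊆I        = ∪-least X⊆I (x∈p⇒⁅x⁆⊆p (All.head xs⊆I))
    ; X⊆J        = ∪-least X⊆J (x∈p⇒⁅x⁆⊆p x∈J)
    ; xs⊆I       = All.tail xs⊆I
    ; I⊆X∪xs     = I⊆X+x∪xs
    ; decreasing = AllPairs.tail decreasing
    ; X-above-xs = X+x-above-xs
    }
    where
    open Invariant inv

    I⊆X+x∪xs : ∀ {z} → z ∈ I → z ∈ X ∪ ⁅ x ⁆ ⊎ z ∈ₗ xs
    I⊆X+x∪xs z∈I with I⊆X∪xs z∈I
    ... | inj₁ z∈X          = inj₁ (p⊆p∪q ⁅ x ⁆ z∈X)
    ... | inj₂ (here refl)  = inj₁ (q⊆p∪q X ⁅ x ⁆ (x∈⁅x⁆ x))
    ... | inj₂ (there z∈xs) = inj₂ z∈xs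

    X+x-above-xs : ∀ {z} → z ∈ X ∪ ⁅ x ⁆ → All (_< z) xs
    X+x-above-xs z∈X+x with x∈p∪⁅y⁆⁻ z∈X+x
    ... | inj₁ z∈X  = All.tail (X-above-xs z∈X)
    ... | inj₂ refl = AllPairs.head decreasing

  module _ {L′ X} (inv : Invariant L′ X []) where
    open Invariant inv

    equal⇒J─X-Empty : I ≡ J → Empty (J ─ X)
    equal⇒J─X-Empty I≡J (z , z∈J─X) with I⊆X∪xs (subst (z ∈_) (sym I≡J) (p─q⊆p J X z∈J─X))
    ... | inj₁ z∈X = x∈p─q⇒x∉q J X z∈J─X z∈X

    J─X-Empty⇒equal : Empty (J ─ X) → I ≡ J
    J─X-Empty⇒equal J─X-empty = ⊆-antisym I⊆J J⊆I
      where
      I⊆J : I ⊆ J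
      I⊆J z∈I with I⊆X∪xs z∈I
      ... | inj₁ z∈X = X⊆J z∈X

      J⊆I : J ⊆ I
      J⊆I {z} z∈J with z ∈? X
      ... | yes z∈X = X⊆I z∈X
      ... | no  z∉X = contradiction (z , x∈p∧x∉q⇒x∈p─q z∈J z∉X) J─X-empty

  module _ {L′ X x xs} (inv : Invariant L′ X (x ∷ xs)) (x∉J─X : x ∉ J ─ X) where
    open Invariant inv

    head-∉J : x ∉ J
    head-∉J x∈J = x∉J─X (x∈p∧x∉q⇒x∈p─q x∈J (λ x∈X → <-irrefl refl (All.head (X-above-xs x∈X))))

    no-partner : ∀ {y} → y ∈ J ─ X → L′ (⁅ x ⁆ ∪ ⁅ y ⁆) ≢ true
    no-partner y∈J─X x+y∈L′ =
      no-circuit-containing-pair L I-free J-free (All.head xs⊆I) (p─q⊆p J X y∈J─X)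
        (λ { refl → x∉J─X y∈J─X }) X⊆I X⊆J (All.head ∘ X-above-xs)
        (liftable (⁅ x ⁆ ∪ ⁅ _ ⁆) x+y∈L′)

  pChain-kronecker : ∀ (rk : Subset n → ℕ) L′ X xs s → Invariant L′ X xs →
                     Kronecker _≡_ s (+ 0) I J (pChain rk L′ xs (J ─ X , s))
  pChain-kronecker rk L′ X [] s inv =
    (λ I≡J → pChain-[]-Empty rk L′ (equal⇒J─X-Empty inv I≡J)) ,
    (λ I≢J → pChain-[]-¬Empty rk L′ (I≢J ∘ J─X-Empty⇒equal inv))
  pChain-kronecker rk L′ X (x ∷ xs) s inv with x ∈? J ─ X
  ... | yes x∈J─X =
    subst (Kronecker _≡_ s (+ 0) I J) (sym contract-x)
      (pChain-kronecker (contrRank rk x) (contrClass rk L′ x) (X ∪ ⁅ x ⁆) xs s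
        (invariant-step rk inv (p─q⊆p J X x∈J─X)))
    where
    open ≡-Reasoning
    continue : Subset n → ℤ
    continue J′ = pChain (contrRank rk x) (contrClass rk L′ x) xs (J′ , s)

    contract-x : pChain rk L′ (x ∷ xs) (J ─ X , s) ≡ continue (J ─ (X ∪ ⁅ x ⁆))
    contract-x = begin
      pChain rk L′ (x ∷ xs) (J ─ X , s)  ≡⟨ pChain-∷-∈ rk L′ {s = s} {xs = xs} x∈J─X ⟩
      continue (J ─ X ─ ⁅ x ⁆)           ≡⟨ cong continue (p─q─r≡p─q∪r J X ⁅ x ⁆) ⟩
      continue (J ─ (X ∪ ⁅ x ⁆))         ∎
  ... | no x∉J─X =
    (λ I≡J → contradiction (subst (x ∈_) I≡J (All.head (Invariant.xs⊆I inv))) (head-∉J inv x∉J─X)) ,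
    (λ _ → pChain-∷-∉ rk L′ {s = s} {xs = xs} x∉J─X (no-partner inv x∉J─X))

  pChain-elemsDesc-kronecker :
    Kronecker _≡_ (+ 1) (+ 0) I J (pChain (Matroid.rank M) inL (elemsDesc I) (J , + 1))
  pChain-elemsDesc-kronecker =
    subst (λ J′ → Kronecker _≡_ (+ 1) (+ 0) I J
                    (pChain (Matroid.rank M) inL (elemsDesc I) (J′ , + 1)))
      (p─⊥≡p J) (pChain-kronecker (Matroid.rank M) inL ⊥ (elemsDesc I) (+ 1) invariant-init)

theorem3p17 : ∀ {n c ℓ} (M : Matroid n) (L : LinearClass M) (K : Field c ℓ) →
    -- graded statement: 𝔭_I (e_J) = δ_IJ for I, J ∈ NBC with |I| = |J|
    (∀ I J → NBC L I → NBC L J → ∣ I ∣ ≡ ∣ J ∣ →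
      (I ≡ J → Field._≈_ K (pForm K M L I J) (Field.1# K)) ×
      (I ≢ J → Field._≈_ K (pForm K M L I J) (Field.0# K))) ×
    -- consequence: dual basis of the whole nbc family
    (∀ I J → NBC L I → NBC L J →
      (I ≡ J → Field._≈_ K (pForm K M L I J) (Field.1# K)) ×
      (I ≢ J → Field._≈_ K (pForm K M L I J) (Field.0# K)))
theorem3p17 M L K = (λ I J I-nbc J-nbc _ → pForm-kronecker I J I-nbc J-nbc) , pForm-kronecker
  where
  open Field K using (_≈_; 1#; 0#; +-identityʳ)

  pForm-kronecker : ∀ I J → NBC L I → NBC L J → Kronecker _≈_ 1# 0# I J (pForm K M L I J)
  pForm-kronecker I J (_ , I-free) (_ , J-free) =
    Kronecker-map {_≈_ = _≈_} (ℤ→K K) (+-identityʳ 1#) (Field.refl K)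
      (Duality.pChain-elemsDesc-kronecker L I-free J-free)
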